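{- Let $n\ge3$ and $\lambda,\mu\in S_{2n}$. If $\mathrm{class}(\lambda)=\mathrm{class}(\mu)$, then $\mathrm{par}(\lambda)=\mathrm{par}(\mu)$.
   Context: A Dyck path of size $n$ is a word in $\mathtt{u},\mathtt{d}$ with $n$ of each letter whose every prefix has at least as many $\mathtt{u}$'s as $\mathtt{d}$'s; $\mathcal{D}_n$ is their set. The tunneling $\tau_D\in S_{2n}$ of $D$ is the fixed-point-free involution pairing each up-step position with the position of its matching down-step. For $\sigma\in S_{2n}$, $\sigma_k=\sigma(k)$, $\sigma_{[k]}=\{\sigma_1,\dots,\sigma_k\}$; the $\sigma$-path $\sigma(D)$ has $\sigma(D)_k=\mathtt{u}$ if $\tau_D(\sigma_k)\notin\sigma_{[k]}$ and $\mathtt{d}$ otherwise. $\lambda\sim\mu$ iff $\lambda(D)=\mu(D)$ for all $D\in\mathcal{D}_n$; $\mathrm{class}(\sigma)$ is the class of $\sigma$. The parity $\mathrm{par}(\sigma)$ is the pair $(a,b)$ where $a$ is the smallest positive integer with $\sigma_a\not\equiv\sigma_{a+1}\pmod 2$ and $b$ is the smallest positive integer with $\sigma_{2n+1-b}\not\equiv\sigma_{2n-b}\pmod 2$. -}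

module Defs where

open import Data.Bool using (Bool; true; false; if_then_else_; _∧_; not)
open import Data.Nat using (ℕ; zero; suc; _+_; _*_; _≤_; _<ᵇ_; _≤ᵇ_; _≡ᵇ_; _%_)
open import Data.Integer using (ℤ; +_; _-_)
import Data.Integer as ℤ
open import Data.Fin using (Fin; toℕ)
open import Data.List using (List; length; filterᵇ; findᵇ; reverse; allFin)
open import Data.Bool.ListAction using (any)
open import Data.Maybe using (Maybe; just; nothing)
open import Data.Product using (_×_; _,_)
open import Data.Fin.Permutation using (Permutation′; _⟨$⟩ʳ_)
open import Relation.Binary.PropositionalEquality using (_≡_)
open import Relation.Nullary.Decidable using (⌊_⌋)

-- Positions 1..m of the paper are represented 0-based by Fin m
-- (position p of the paper is the element of Fin m with toℕ = p - 1).

data Step : Set where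
  u d : Step

isU : Step → Bool
isU u = true
isU d = false

isD : Step → Bool
isD s = not (isU s)

Word : ℕ → Set
Word m = Fin m → Step

ups : ∀ {m} → Word m → ℕ → ℕ
ups {m} w k = length (filterᵇ (λ i → (toℕ i <ᵇ k) ∧ isU (w i)) (allFin m))

downs : ∀ {m} → Word m → ℕ → ℕ
downs {m} w k = length (filterᵇ (λ i → (toℕ i <ᵇ k) ∧ isD (w i)) (allFin m))

record Dyck (n : ℕ) : Set where
  field
    word     : Word (2 * n)
    ups-n    : ups word (2 * n) ≡ n
    downs-n  : downs word (2 * n) ≡ n
    prefix   : ∀ k → k ≤ 2 * n → downs word k ≤ ups word k
open Dyck public

height : ∀ {m} → Word m → ℕ → ℤ
height w k = (+ ups w k) - (+ downs w k)

_=ℤ_ : ℤ → ℤ → Bool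
x =ℤ y = ⌊ x ℤ.≟ y ⌋

_=F_ : ∀ {m} → Fin m → Fin m → Bool
i =F j = toℕ i ≡ᵇ toℕ j

-- Tunneling: the partner of position i under the matching of u's and d's.
-- An up-step at i is matched with the first later position j with
-- height (j+1) = height i; a down-step at i with the last earlier
-- position j with height j = height (i+1).  (For Dyck paths this is
-- always defined; 'nothing' never occurs.)
tunnel : ∀ {m} → Word m → Fin m → Maybe (Fin m)
tunnel {m} w i with w i
... | u = findᵇ (λ j → (toℕ i <ᵇ toℕ j) ∧ (height w (suc (toℕ j)) =ℤ height w (toℕ i))) (allFin m)
... | d = findᵇ (λ j → (toℕ j <ᵇ toℕ i) ∧ (height w (toℕ j) =ℤ height w (suc (toℕ i)))) (reverse (allFin m))

_=MF_ : ∀ {m} → Maybe (Fin m) → Fin m → Bool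
just i  =MF j = i =F j
nothing =MF j = false

σPath : ∀ {m} → Permutation′ m → Word m → Word m
σPath {m} σ w k =
  if any (λ l → (toℕ l ≤ᵇ toℕ k) ∧ (tunnel w (σ ⟨$⟩ʳ k) =MF (σ ⟨$⟩ʳ l))) (allFin m)
  then d else u

-- λ ∼ μ (i.e. class(λ) = class(μ)): equal σ-paths on every Dyck path of size n
_∼_ : ∀ {n} → Permutation′ (2 * n) → Permutation′ (2 * n) → Set
_∼_ {n} λ' μ = ∀ (D : Dyck n) (k : Fin (2 * n)) → σPath λ' (word D) k ≡ σPath μ (word D) k

-- parity of the (1-based) value σ_k; shifting values by one preserves
-- (in)equality of parities, so we use the 0-based value toℕ (σ ⟨$⟩ʳ k).
parityAt : ∀ {m} → Permutation′ m → ℕ → ℕ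
parityAt {m} σ p = lookupPar (allFin m)
  where
    lookupPar : List (Fin m) → ℕ
    lookupPar xs with findᵇ (λ i → toℕ i ≡ᵇ p) xs
    ... | just i  = toℕ (σ ⟨$⟩ʳ i) % 2
    ... | nothing = 0

-- a = smallest positive a with σ_a ≢ σ_{a+1} (mod 2) (1-based positions a, a+1,
-- i.e. 0-based positions a-1, a); b = smallest positive b with
-- σ_{2n+1-b} ≢ σ_{2n-b} (mod 2) (0-based positions m-b, m-b-1).
-- Searches range over b (resp. a) in 1..m-1; result 0 if none (never
-- happens for a permutation of m ≥ 2 elements).
firstFrom : (ℕ → Bool) → ℕ → ℕ → ℕ
firstFrom p zero    a = 0
firstFrom p (suc f) a = if p a then a else firstFrom p f (suc a)

par : ∀ {m} → Permutation′ m → ℕ × ℕ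
par {m} σ =
  ( firstFrom (λ a → not (parityAt σ (a ∸ 1) ≡ᵇ parityAt σ a)) m 1
  , firstFrom (λ b → not (parityAt σ (m ∸ b) ≡ᵇ parityAt σ (m ∸ b ∸ 1))) m 1 )
  where open import Data.Nat using (_∸_)

-- The k-th letter of σ(D) is d exactly when the tunnel partner of σ_k lies among σ_1, …, σ_k.
-- Heights change by one at each step, so a tunnel always joins positions of opposite parity;
-- conversely, two positions of opposite parity are joined in the Dyck path that zigzags between
-- heights 0 and 1 except for a single excursion between them. Hence letter k is u for every D if
-- σ_1, …, σ_k share the parity of σ_k, and d for some D otherwise; it is d for every D if
-- σ_k, …, σ_2n share the parity of σ_k, and u for some D if σ_{k+1} has the other parity. So the
-- class of σ determines where the initial and the final run of equal parities of σ end, and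
-- par σ records the lengths of these two runs.

module Submission where

open import Algebra.Properties.CommutativeSemigroup using (x∙yz≈y∙xz)
open import Data.Bool using (Bool; true; false; if_then_else_; _∧_; not; T)
open import Data.Bool.Properties using (T-∧; T-≡; not-injective)
open import Data.Empty using (⊥-elim)
open import Data.Fin using (Fin; toℕ; fromℕ<) renaming (zero to fzero; suc to fsuc)
open import Data.Fin.Permutation using (Permutation′; _⟨$⟩ʳ_; _⟨$⟩ˡ_; inverseʳ; inverseˡ)
open import Data.Fin.Properties using (toℕ-fromℕ<; toℕ<n; toℕ-injective)
import Data.Integer as ℤ
import Data.Integer.Properties as ℤᵖ
open import Data.List using ([]; _∷_; _++_; [_]; length; filterᵇ; findᵇ; reverse; tabulate; allFin)
open import Data.List.Properties using (unfold-reverse)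
open import Data.List.Relation.Unary.Any using (Any; here; there)
import Data.List.Relation.Unary.Any.Properties as Any
open import Data.Maybe using (Maybe; just; nothing)
open import Data.Maybe.Properties using (just-injective)
open import Data.Nat
  using (ℕ; zero; suc; _+_; _*_; _∸_; _≤_; _<_; z≤n; s≤s; s≤s⁻¹; z<s; s<s; s<s⁻¹; _<ᵇ_; _≤ᵇ_; _≡ᵇ_; _%_; parity)
open import Data.Nat.DivMod using ([m+n]%n≡m%n)
open import Data.Nat.Properties
open import Data.Parity using (Parity; 0ℙ; 1ℙ; _⁻¹) renaming (_+_ to _+ℙ_)
import Data.Parity.Properties as ℙ
open import Data.Product using (_×_; _,_; proj₁; proj₂; ∃)
open import Data.Sum using (_⊎_; inj₁; inj₂)
open import Data.Unit using (tt)
open import Function using (_∘_; id; Equivalence; _⇔_; mk⇔)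
import Function.Properties.Equivalence as ⇔
open import Relation.Binary.Definitions using (tri<; tri≈; tri>)
open import Relation.Binary.PropositionalEquality hiding ([_])
open import Relation.Nullary using (¬_; contradiction; yes; no; proof)
open import Relation.Nullary.Decidable using (toWitness; fromWitness)
open import Relation.Nullary.Reflects using (Reflects; ofʸ; ofⁿ; ¬-reflects)

open import Defs

if-T : ∀ {A : Set} {b} {x y : A} → T b → (if b then x else y) ≡ x
if-T {b = true} _ = refl

if-¬T : ∀ {A : Set} {b} {x y : A} → ¬ T b → (if b then x else y) ≡ y
if-¬T {b = false} _  = refl
if-¬T {b = true}  ¬t = ⊥-elim (¬t tt)

bit : Parity → ℕ
bit 0ℙ = 0
bit 1ℙ = 1

bit-injective : ∀ {p q} → bit p ≡ bit q → p ≡ q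
bit-injective {0ℙ} {0ℙ} _ = refl
bit-injective {1ℙ} {1ℙ} _ = refl

%2≡bit∘parity : ∀ n → n % 2 ≡ bit (parity n)
%2≡bit∘parity 0 = refl
%2≡bit∘parity 1 = refl
%2≡bit∘parity (suc (suc n)) = begin
  suc (suc n) % 2  ≡⟨ cong (_% 2) (+-comm 2 n) ⟩
  (n + 2) % 2      ≡⟨ [m+n]%n≡m%n n 2 ⟩
  n % 2            ≡⟨ %2≡bit∘parity n ⟩
  bit (parity n)   ∎
  where open ≡-Reasoning

parity-suc : ∀ n → parity (suc n) ≡ parity n ⁻¹
parity-suc n = sym (ℙ.⁻¹-selfInverse (ℙ.suc-homo-⁻¹ n))

parity-suc-≢ : ∀ a b → parity (suc a) ≡ parity b → parity a ≢ parity b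
parity-suc-≢ a b sa≡b a≡b = ℙ.p≢p⁻¹ (parity a) (trans a≡b (trans (sym sa≡b) (parity-suc a)))

≢⇒⁻¹≡ : ∀ {p q} → p ≢ q → p ⁻¹ ≡ q
≢⇒⁻¹≡ {0ℙ} {0ℙ} p≢q = contradiction refl p≢q
≢⇒⁻¹≡ {0ℙ} {1ℙ} _   = refl
≢⇒⁻¹≡ {1ℙ} {0ℙ} _   = refl
≢⇒⁻¹≡ {1ℙ} {1ℙ} p≢q = contradiction refl p≢q

induction-≤ : ∀ {m} (P : ℕ → Set) → P 0 → (∀ (t : Fin m) → P (toℕ t) → P (suc (toℕ t))) →
              ∀ k → k ≤ m → P k
induction-≤ P base step zero    _   = base
induction-≤ P base step (suc k) k<m =
  subst (P ∘ suc) (toℕ-fromℕ< k<m)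
        (step (fromℕ< k<m) (subst P (sym (toℕ-fromℕ< k<m)) (induction-≤ P base step k (<⇒≤ k<m))))

count : ∀ {m} → (Fin m → Bool) → ℕ
count {zero}  f = 0
count {suc m} f = (if f fzero then 1 else 0) + count (f ∘ fsuc)

length-filterᵇ-tabulate : ∀ {A : Set} {m} (p : A → Bool) (g : Fin m → A) →
                          length (filterᵇ p (tabulate g)) ≡ count (p ∘ g)
length-filterᵇ-tabulate {m = zero}  p g = refl
length-filterᵇ-tabulate {m = suc m} p g with p (g fzero)
... | true  = cong suc (length-filterᵇ-tabulate p (g ∘ fsuc))
... | false = length-filterᵇ-tabulate p (g ∘ fsuc)

countBelow : ∀ {m} → (Fin m → Bool) → ℕ → ℕ
countBelow f k = count (λ i → (toℕ i <ᵇ k) ∧ f i)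

countBelow-zero : ∀ {m} (f : Fin m → Bool) → countBelow f 0 ≡ 0
countBelow-zero {zero}  f = refl
countBelow-zero {suc m} f = countBelow-zero (f ∘ fsuc)

countBelow-suc : ∀ {m} (f : Fin m → Bool) (t : Fin m) →
                 countBelow f (suc (toℕ t)) ≡ (if f t then 1 else 0) + countBelow f (toℕ t)
countBelow-suc {suc m} f fzero =
  cong ((if f fzero then 1 else 0) +_) (trans (countBelow-zero (f ∘ fsuc)) (sym (countBelow-zero f)))
countBelow-suc {suc m} f (fsuc t) =
  trans (cong ((if f fzero then 1 else 0) +_) (countBelow-suc (f ∘ fsuc) t))
        (x∙yz≈y∙xz +-commutativeSemigroup (if f fzero then 1 else 0) (if f (fsuc t) then 1 else 0) _)

countBelow-complement : ∀ {m} (f : Fin m → Bool) k → k ≤ m → countBelow f k + countBelow (not ∘ f) k ≡ k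
countBelow-complement {m} f = induction-≤ _ base step
  where
  base : countBelow f 0 + countBelow (not ∘ f) 0 ≡ 0
  base = cong₂ _+_ (countBelow-zero f) (countBelow-zero (not ∘ f))
  step : ∀ (t : Fin m) → countBelow f (toℕ t) + countBelow (not ∘ f) (toℕ t) ≡ toℕ t →
         countBelow f (suc (toℕ t)) + countBelow (not ∘ f) (suc (toℕ t)) ≡ suc (toℕ t)
  step t ih rewrite countBelow-suc f t | countBelow-suc (not ∘ f) t with f t
  ... | true  = cong suc ih
  ... | false = trans (+-suc _ _) (cong suc ih)

ups≡countBelow : ∀ {m} (w : Word m) k → ups w k ≡ countBelow (isU ∘ w) k
ups≡countBelow w k = length-filterᵇ-tabulate (λ i → (toℕ i <ᵇ k) ∧ isU (w i)) id

downs≡countBelow : ∀ {m} (w : Word m) k → downs w k ≡ countBelow (isD ∘ w) k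
downs≡countBelow w k = length-filterᵇ-tabulate (λ i → (toℕ i <ᵇ k) ∧ isD (w i)) id

ups-zero : ∀ {m} (w : Word m) → ups w 0 ≡ 0
ups-zero w = trans (ups≡countBelow w 0) (countBelow-zero (isU ∘ w))

downs-zero : ∀ {m} (w : Word m) → downs w 0 ≡ 0
downs-zero w = trans (downs≡countBelow w 0) (countBelow-zero (isD ∘ w))

ups-suc : ∀ {m} (w : Word m) t → ups w (suc (toℕ t)) ≡ (if isU (w t) then 1 else 0) + ups w (toℕ t)
ups-suc w t = trans (ups≡countBelow w (suc (toℕ t)))
  (trans (countBelow-suc (isU ∘ w) t) (cong ((if isU (w t) then 1 else 0) +_) (sym (ups≡countBelow w (toℕ t)))))

downs-suc : ∀ {m} (w : Word m) t → downs w (suc (toℕ t)) ≡ (if isD (w t) then 1 else 0) + downs w (toℕ t)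
downs-suc w t = trans (downs≡countBelow w (suc (toℕ t)))
  (trans (countBelow-suc (isD ∘ w) t) (cong ((if isD (w t) then 1 else 0) +_) (sym (downs≡countBelow w (toℕ t)))))

ups+downs : ∀ {m} (w : Word m) k → k ≤ m → ups w k + downs w k ≡ k
ups+downs w k k≤m rewrite ups≡countBelow w k | downs≡countBelow w k = countBelow-complement (isU ∘ w) k k≤m

find-sound : ∀ {A : Set} (p : A → Bool) xs {y} → findᵇ p xs ≡ just y → T (p y)
find-sound p (x ∷ xs) eq with p x in px
... | true  = subst (T ∘ p) (just-injective eq) (subst T (sym px) tt)
... | false = find-sound p xs eq

find-total : ∀ {A : Set} (p : A → Bool) {xs} → Any (T ∘ p) xs → ∃ λ y → findᵇ p xs ≡ just y
find-total p {x ∷ xs} any with p x in px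
... | true = x , refl
find-total p (here t)  | false = ⊥-elim (subst T px t)
find-total p (there a) | false = find-total p a

find-nothing : ∀ {A : Set} (p : A → Bool) xs → ¬ Any (T ∘ p) xs → findᵇ p xs ≡ nothing
find-nothing p []       _    = refl
find-nothing p (x ∷ xs) none with p x in px
... | true  = ⊥-elim (none (here (subst T (sym px) tt)))
... | false = find-nothing p xs (none ∘ there)

find-++ˡ : ∀ {A : Set} (p : A → Bool) xs ys {y} → findᵇ p xs ≡ just y → findᵇ p (xs ++ ys) ≡ just y
find-++ˡ p (x ∷ xs) ys eq with p x
... | true  = eq
... | false = find-++ˡ p xs ys eq

find-++ʳ : ∀ {A : Set} (p : A → Bool) xs ys → findᵇ p xs ≡ nothing → findᵇ p (xs ++ ys) ≡ findᵇ p ys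
find-++ʳ p []       ys eq = refl
find-++ʳ p (x ∷ xs) ys eq with p x
... | false = find-++ʳ p xs ys eq

find-singleton : ∀ {A : Set} (p : A → Bool) x → T (p x) → findᵇ p [ x ] ≡ just x
find-singleton p x px with p x
... | true = refl

find-first : ∀ {A : Set} {m} (p : A → Bool) (f : Fin m → A) (j : Fin m) → T (p (f j)) →
             (∀ i → toℕ i < toℕ j → ¬ T (p (f i))) → findᵇ p (tabulate f) ≡ just (f j)
find-first p f fzero pj before with p (f fzero)
... | true = refl
find-first p f (fsuc j) pj before with p (f fzero) | before fzero z<s
... | true  | ¬p0 = ⊥-elim (¬p0 tt)
... | false | _   = find-first p (f ∘ fsuc) j pj (λ i i<j → before (fsuc i) (s<s i<j))

find-last : ∀ {A : Set} {m} (p : A → Bool) (f : Fin m → A) (j : Fin m) → T (p (f j)) →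
            (∀ i → toℕ j < toℕ i → ¬ T (p (f i))) → findᵇ p (reverse (tabulate f)) ≡ just (f j)
find-last p f fzero pj after rewrite unfold-reverse (f fzero) (tabulate (f ∘ fsuc)) =
  trans (find-++ʳ p (reverse (tabulate (f ∘ fsuc))) [ f fzero ] (find-nothing p _ none)) (find-singleton p (f fzero) pj)
  where
  none : ¬ Any (T ∘ p) (reverse (tabulate (f ∘ fsuc)))
  none a with i , pi ← Any.tabulate⁻ (Any.reverse⁻ a) = after (fsuc i) z<s pi
find-last p f (fsuc j) pj after rewrite unfold-reverse (f fzero) (tabulate (f ∘ fsuc)) =
  find-++ˡ p (reverse (tabulate (f ∘ fsuc))) [ f fzero ]
    (find-last p (f ∘ fsuc) j pj (λ i j<i → after (fsuc i) (s<s j<i)))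

Adjacent : ℕ → ℕ → Set
Adjacent x y = y ≡ suc x ⊎ x ≡ suc y

adjacent-≤ : ∀ {x y} → Adjacent x y → y ≤ suc x
adjacent-≤ (inj₁ refl) = ≤-refl
adjacent-≤ (inj₂ refl) = ≤-trans (n≤1+n _) (n≤1+n _)

adjacent-≥ : ∀ {x y} → Adjacent x y → x ≤ suc y
adjacent-≥ (inj₁ refl) = ≤-trans (n≤1+n _) (n≤1+n _)
adjacent-≥ (inj₂ refl) = ≤-refl

adjacent-+ : ∀ k {x y} → Adjacent x y → Adjacent (k + x) (k + y)
adjacent-+ k (inj₁ refl) = inj₁ (+-suc k _)
adjacent-+ k (inj₂ refl) = inj₂ (+-suc k _)

descends-through : ∀ (f : ℕ → ℕ) {a b c} → (∀ t → t < b → f t ≤ suc (f (suc t))) →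
                   a ≤ b → c < f a → f b ≤ c → ∃ λ t → a < t × t ≤ b × f t ≡ c
descends-through f {b = zero} steps z≤n c<fa fb≤c = contradiction c<fa (≤⇒≯ fb≤c)
descends-through f {a} {suc b} {c} steps a≤1+b c<fa f[1+b]≤c with m≤n⇒m<n∨m≡n a≤1+b
... | inj₂ refl = contradiction c<fa (≤⇒≯ f[1+b]≤c)
... | inj₁ a<1+b with f b ≤? c
...   | yes fb≤c =
  let t , a<t , t≤b , ft≡c = descends-through f (λ t t<b → steps t (m<n⇒m<1+n t<b)) (s≤s⁻¹ a<1+b) c<fa fb≤c
  in  t , a<t , m≤n⇒m≤1+n t≤b , ft≡c
...   | no fb≰c = suc b , a<1+b , ≤-refl ,
  ≤-antisym f[1+b]≤c (s≤s⁻¹ (≤-trans (≰⇒> fb≰c) (steps b (n<1+n b))))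

ascends-through : ∀ (f : ℕ → ℕ) {a b c} → (∀ t → t < b → f (suc t) ≤ suc (f t)) →
                  a ≤ b → f a ≤ c → c < f b → ∃ λ t → a ≤ t × t < b × f t ≡ c
ascends-through f {b = zero} steps z≤n fa≤c c<fb = contradiction c<fb (≤⇒≯ fa≤c)
ascends-through f {a} {suc b} {c} steps a≤1+b fa≤c c<f[1+b] with m≤n⇒m<n∨m≡n a≤1+b
... | inj₂ refl = contradiction c<f[1+b] (≤⇒≯ fa≤c)
... | inj₁ a<1+b with c <? f b
...   | yes c<fb =
  let t , a≤t , t<b , ft≡c = ascends-through f (λ t t<b → steps t (m<n⇒m<1+n t<b)) (s≤s⁻¹ a<1+b) fa≤c c<fb
  in  t , a≤t , m<n⇒m<1+n t<b , ft≡c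
...   | no c≮fb = b , s≤s⁻¹ a<1+b , n<1+n b ,
  ≤-antisym (≮⇒≥ c≮fb) (s≤s⁻¹ (≤-trans c<f[1+b] (steps b (n<1+n b))))

-- Height functions

matchesUp : ∀ {m} → Word m → Fin m → Fin m → Bool
matchesUp w i j = (toℕ i <ᵇ toℕ j) ∧ (height w (suc (toℕ j)) =ℤ height w (toℕ i))

matchesDown : ∀ {m} → Word m → Fin m → Fin m → Bool
matchesDown w i j = (toℕ j <ᵇ toℕ i) ∧ (height w (toℕ j) =ℤ height w (suc (toℕ i)))

tunnel-u : ∀ {m} (w : Word m) x → w x ≡ u → tunnel w x ≡ findᵇ (matchesUp w x) (allFin m)
tunnel-u w x eq with w x
tunnel-u w x refl | u = refl

tunnel-d : ∀ {m} (w : Word m) x → w x ≡ d → tunnel w x ≡ findᵇ (matchesDown w x) (reverse (allFin m))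
tunnel-d w x eq with w x
tunnel-d w x refl | d = refl

record IsHeight {m} (w : Word m) (H : ℕ → ℕ) : Set where
  field
    start : H 0 ≡ 0
    up    : ∀ t → w t ≡ u → H (suc (toℕ t)) ≡ suc (H (toℕ t))
    down  : ∀ t → w t ≡ d → H (toℕ t) ≡ suc (H (suc (toℕ t)))

module HeightFunction {m} {w : Word m} {H : ℕ → ℕ} (isHeight : IsHeight w H) where
  open IsHeight isHeight

  ups≡downs+H : ∀ k → k ≤ m → ups w k ≡ downs w k + H k
  ups≡downs+H = induction-≤ _ base step
    where
    base : ups w 0 ≡ downs w 0 + H 0
    base = trans (ups-zero w) (sym (cong₂ _+_ (downs-zero w) start))
    step : ∀ t → ups w (toℕ t) ≡ downs w (toℕ t) + H (toℕ t) →
           ups w (suc (toℕ t)) ≡ downs w (suc (toℕ t)) + H (suc (toℕ t))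
    step t ih rewrite ups-suc w t | downs-suc w t with w t in e
    ... | u rewrite up t e = trans (cong suc ih) (sym (+-suc _ _))
    ... | d = trans ih (trans (cong (downs w (toℕ t) +_) (down t e)) (+-suc _ _))

  height≡H : ∀ k → k ≤ m → height w k ≡ ℤ.+ H k
  height≡H k k≤m = begin
    ℤ.+ ups w k ℤ.- ℤ.+ downs w k            ≡⟨ cong (λ x → ℤ.+ x ℤ.- ℤ.+ downs w k) (ups≡downs+H k k≤m) ⟩
    ℤ.+ (downs w k + H k) ℤ.- ℤ.+ downs w k  ≡⟨ ℤᵖ.[+m]-[+n]≡m⊖n (downs w k + H k) (downs w k) ⟩
    (downs w k + H k) ℤ.⊖ downs w k          ≡⟨ ℤᵖ.⊖-≥ (m≤m+n (downs w k) (H k)) ⟩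
    ℤ.+ (downs w k + H k ∸ downs w k)        ≡⟨ cong ℤ.+_ (m+n∸m≡n (downs w k) (H k)) ⟩
    ℤ.+ H k                                  ∎
    where open ≡-Reasoning

  =ℤ⇒H≡ : ∀ {a b} → a ≤ m → b ≤ m → T (height w a =ℤ height w b) → H a ≡ H b
  =ℤ⇒H≡ a≤m b≤m eq =
    ℤᵖ.+-injective (trans (sym (height≡H _ a≤m)) (trans (toWitness eq) (height≡H _ b≤m)))

  H≡⇒=ℤ : ∀ {a b} → a ≤ m → b ≤ m → H a ≡ H b → T (height w a =ℤ height w b)
  H≡⇒=ℤ a≤m b≤m eq = fromWitness (trans (height≡H _ a≤m) (trans (cong ℤ.+_ eq) (sym (height≡H _ b≤m))))

  parity-H : ∀ k → k ≤ m → parity (H k) ≡ parity k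
  parity-H = induction-≤ _ (cong parity start) step
    where
    step : ∀ t → parity (H (toℕ t)) ≡ parity (toℕ t) → parity (H (suc (toℕ t))) ≡ parity (suc (toℕ t))
    step t ih with w t in e
    ... | u = begin
      parity (H (suc (toℕ t)))  ≡⟨ cong parity (up t e) ⟩
      parity (suc (H (toℕ t)))  ≡⟨ parity-suc (H (toℕ t)) ⟩
      parity (H (toℕ t)) ⁻¹     ≡⟨ cong _⁻¹ ih ⟩
      parity (toℕ t) ⁻¹         ≡⟨ sym (parity-suc (toℕ t)) ⟩
      parity (suc (toℕ t))      ∎
      where open ≡-Reasoning
    ... | d = trans (sym (ℙ.⁻¹-selfInverse flipped)) (sym (parity-suc (toℕ t)))
      where
      flipped : parity (H (suc (toℕ t))) ⁻¹ ≡ parity (toℕ t)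
      flipped = trans (sym (parity-suc (H (suc (toℕ t))))) (trans (cong parity (sym (down t e))) ih)

  same-height⇒same-parity : ∀ {a b} → a ≤ m → b ≤ m → H a ≡ H b → parity a ≡ parity b
  same-height⇒same-parity a≤m b≤m eq = trans (sym (parity-H _ a≤m)) (trans (cong parity eq) (parity-H _ b≤m))

  adjacent : ∀ t → t < m → Adjacent (H t) (H (suc t))
  adjacent t t<m with w (fromℕ< t<m) in e
  ... | u = inj₁ (subst (λ s → H (suc s) ≡ suc (H s)) (toℕ-fromℕ< t<m) (up _ e))
  ... | d = inj₂ (subst (λ s → H s ≡ suc (H (suc s))) (toℕ-fromℕ< t<m) (down _ e))

  matchesUp⁺ : ∀ {x y} → toℕ x < toℕ y → H (suc (toℕ y)) ≡ H (toℕ x) → T (matchesUp w x y)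
  matchesUp⁺ {x} {y} x<y eq = Equivalence.from T-∧ (<⇒<ᵇ x<y , H≡⇒=ℤ (toℕ<n y) (<⇒≤ (toℕ<n x)) eq)

  matchesUp⁻ : ∀ {x y} → T (matchesUp w x y) → toℕ x < toℕ y × H (suc (toℕ y)) ≡ H (toℕ x)
  matchesUp⁻ {x} {y} t with x<y , eq ← Equivalence.to T-∧ t =
    <ᵇ⇒< (toℕ x) (toℕ y) x<y , =ℤ⇒H≡ (toℕ<n y) (<⇒≤ (toℕ<n x)) eq

  matchesDown⁺ : ∀ {x y} → toℕ y < toℕ x → H (toℕ y) ≡ H (suc (toℕ x)) → T (matchesDown w x y)
  matchesDown⁺ {x} {y} y<x eq = Equivalence.from T-∧ (<⇒<ᵇ y<x , H≡⇒=ℤ (<⇒≤ (toℕ<n y)) (toℕ<n x) eq)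

  matchesDown⁻ : ∀ {x y} → T (matchesDown w x y) → toℕ y < toℕ x × H (toℕ y) ≡ H (suc (toℕ x))
  matchesDown⁻ {x} {y} t with y<x , eq ← Equivalence.to T-∧ t =
    <ᵇ⇒< (toℕ y) (toℕ x) y<x , =ℤ⇒H≡ (<⇒≤ (toℕ<n y)) (toℕ<n x) eq

  tunnel-flips-parity : ∀ x y → tunnel w x ≡ just y → parity (toℕ x) ≢ parity (toℕ y)
  tunnel-flips-parity x y eq with w x
  ... | u = ≢-sym (parity-suc-≢ (toℕ y) (toℕ x)
              (same-height⇒same-parity (toℕ<n y) (<⇒≤ (toℕ<n x)) level))
    where level = proj₂ (matchesUp⁻ (find-sound (matchesUp w x) (allFin m) eq))
  ... | d = parity-suc-≢ (toℕ x) (toℕ y)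
              (sym (same-height⇒same-parity (<⇒≤ (toℕ<n y)) (toℕ<n x) level))
    where level = proj₂ (matchesDown⁻ (find-sound (matchesDown w x) (reverse (allFin m)) eq))

  tunnel-total : H m ≡ 0 → ∀ x → ∃ λ y → tunnel w x ≡ just y
  tunnel-total Hm≡0 x with w x in e
  ... | u with descends-through H (λ t t<m → adjacent-≥ (adjacent t t<m)) (toℕ<n x)
                 (≤-reflexive (sym (up x e))) (subst (_≤ H (toℕ x)) (sym Hm≡0) z≤n)
  ...   | suc t , 1+x<1+t , t<m , level =
    find-total (matchesUp w x) (Any.tabulate⁺ y (matchesUp⁺ (subst (toℕ x <_) (sym y≡t) (s<s⁻¹ 1+x<1+t))
                                                          (subst (λ s → H (suc s) ≡ H (toℕ x)) (sym y≡t) level)))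
    where
    y = fromℕ< t<m
    y≡t = toℕ-fromℕ< t<m
  tunnel-total Hm≡0 x | d with ascends-through H (λ t t<x → adjacent-≤ (adjacent t (<-trans t<x (toℕ<n x)))) z≤n
                                 (subst (_≤ H (suc (toℕ x))) (sym start) z≤n) (≤-reflexive (sym (down x e)))
  ...   | t , _ , t<x , level =
    find-total (matchesDown w x) (Any.reverse⁺ (Any.tabulate⁺ y (matchesDown⁺ (subst (_< toℕ x) (sym y≡t) t<x)
                                                              (subst (λ s → H s ≡ H (suc (toℕ x))) (sym y≡t) level))))
    where
    t<m = <-trans t<x (toℕ<n x)
    y = fromℕ< t<m
    y≡t = toℕ-fromℕ< t<m

  tunnel-excursion : ∀ (i j : Fin m) → toℕ i < toℕ j →
                     (∀ t → toℕ i < t → t ≤ toℕ j → H (toℕ i) < H t) →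
                     H (suc (toℕ j)) ≡ H (toℕ i) → tunnel w i ≡ just j × tunnel w j ≡ just i
  tunnel-excursion i j i<j above returns =
    trans (tunnel-u w i wi≡u) (find-first (matchesUp w i) id j (matchesUp⁺ i<j returns) noEarlierReturn) ,
    trans (tunnel-d w j wj≡d) (find-last (matchesDown w j) id i (matchesDown⁺ i<j (sym returns)) noLaterStart)
    where
    wi≡u : w i ≡ u
    wi≡u with w i in e
    ... | u = refl
    ... | d = contradiction (≤-reflexive (sym (down i e))) (<-asym (above (suc (toℕ i)) ≤-refl i<j))
    wj≡d : w j ≡ d
    wj≡d with w j in e
    ... | d = refl
    ... | u = contradiction (trans (sym returns) (up j e)) (<⇒≢ (<-trans (above (toℕ j) i<j ≤-refl) (n<1+n _)))
    noEarlierReturn : ∀ j′ → toℕ j′ < toℕ j → ¬ T (matchesUp w i j′)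
    noEarlierReturn j′ j′<j t with i<j′ , level ← matchesUp⁻ t =
      <-irrefl (sym level) (above (suc (toℕ j′)) (m<n⇒m<1+n i<j′) j′<j)
    noLaterStart : ∀ i′ → toℕ i < toℕ i′ → ¬ T (matchesDown w j i′)
    noLaterStart i′ i<i′ t with i′<j , level ← matchesDown⁻ t =
      <-irrefl (sym (trans level returns)) (above (toℕ i′) i<i′ (<⇒≤ i′<j))

dyckHeight : ∀ {n} → Dyck n → ℕ → ℕ
dyckHeight D k = ups (word D) k ∸ downs (word D) k

dyck-isHeight : ∀ {n} (D : Dyck n) → IsHeight (word D) (dyckHeight D)
dyck-isHeight {n} D = record { start = start ; up = up ; down = down }
  where
  w = word D
  start : dyckHeight D 0 ≡ 0
  start = cong₂ _∸_ (ups-zero w) (downs-zero w)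
  up : ∀ t → w t ≡ u → dyckHeight D (suc (toℕ t)) ≡ suc (dyckHeight D (toℕ t))
  up t e rewrite ups-suc w t | downs-suc w t | e = +-∸-assoc 1 (prefix D (toℕ t) (<⇒≤ (toℕ<n t)))
  down : ∀ t → w t ≡ d → dyckHeight D (toℕ t) ≡ suc (dyckHeight D (suc (toℕ t)))
  down t e with prefix D (suc (toℕ t)) (toℕ<n t)
  ... | balance rewrite ups-suc w t | downs-suc w t | e =
    +-∸-assoc 1 {ups w (toℕ t)} {suc (downs w (toℕ t))} balance

dyckHeight-end : ∀ {n} (D : Dyck n) → dyckHeight D (2 * n) ≡ 0
dyckHeight-end {n} D = trans (cong₂ _∸_ (ups-n D) (downs-n D)) (n∸n≡0 n)

heightFunction⇒dyck : ∀ {n} (w : Word (2 * n)) {H : ℕ → ℕ} → IsHeight w H → H (2 * n) ≡ 0 → Dyck n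
heightFunction⇒dyck {n} w {H} isHeight end =
  record { word = w ; ups-n = trans balanced downs≡n ; downs-n = downs≡n ; prefix = prefix′ }
  where
  open HeightFunction isHeight
  balanced : ups w (2 * n) ≡ downs w (2 * n)
  balanced = trans (ups≡downs+H _ ≤-refl) (trans (cong (downs w (2 * n) +_) end) (+-identityʳ _))
  downs≡n : downs w (2 * n) ≡ n
  downs≡n = *-cancelˡ-≡ _ n 2 (begin
    downs w (2 * n) + (downs w (2 * n) + 0)  ≡⟨ cong₂ _+_ (sym balanced) (+-identityʳ _) ⟩
    ups w (2 * n) + downs w (2 * n)          ≡⟨ ups+downs w (2 * n) ≤-refl ⟩
    2 * n                                    ∎)
    where open ≡-Reasoning
  prefix′ : ∀ k → k ≤ 2 * n → downs w k ≤ ups w k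
  prefix′ k k≤2n = subst (downs w k ≤_) (sym (ups≡downs+H k k≤2n)) (m≤m+n _ _)

-- Excursions

wordOf : ∀ {m} → (ℕ → ℕ) → Word m
wordOf H t = if H (suc (toℕ t)) ≡ᵇ suc (H (toℕ t)) then u else d

wordOf-isHeight : ∀ {m} {H : ℕ → ℕ} → H 0 ≡ 0 → (∀ t → Adjacent (H t) (H (suc t))) →
                  IsHeight (wordOf {m} H) H
wordOf-isHeight {m} {H} start adjacent = record { start = start ; up = up ; down = down }
  where
  up : ∀ t → wordOf H t ≡ u → H (suc (toℕ t)) ≡ suc (H (toℕ t))
  up t e with H (suc (toℕ t)) ≡ᵇ suc (H (toℕ t)) in rises
  ... | true = ≡ᵇ⇒≡ _ _ (subst T (sym rises) tt)
  up t () | false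
  down : ∀ t → wordOf H t ≡ d → H (toℕ t) ≡ suc (H (suc (toℕ t)))
  down t e with H (suc (toℕ t)) ≡ᵇ suc (H (toℕ t)) in rises | adjacent (toℕ t)
  down t () | true  | _
  ... | false | inj₁ rise = ⊥-elim (subst T rises (≡⇒≡ᵇ _ _ rise))
  ... | false | inj₂ fall = fall

zigzag : ℕ → ℕ
zigzag p = bit (parity p)

zigzag-adjacent : ∀ p → Adjacent (zigzag p) (zigzag (suc p))
zigzag-adjacent p rewrite parity-suc p with parity p
... | 0ℙ = inj₁ refl
... | 1ℙ = inj₂ refl

zigzag-double : ∀ n → zigzag (n + n) ≡ 0
zigzag-double n rewrite ℙ.+-homo-+ n n | ℙ.p+p≡0ℙ (parity n) = refl

zigzag-closes : ∀ a b → parity a ≢ parity b → zigzag (suc (a + b)) ≡ 0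
zigzag-closes a b a≢b = cong bit (begin
  parity (suc (a + b))           ≡⟨ parity-suc (a + b) ⟩
  parity (a + b) ⁻¹              ≡⟨ cong _⁻¹ (ℙ.+-homo-+ a b) ⟩
  (parity a +ℙ parity b) ⁻¹      ≡⟨ cong (λ q → (q +ℙ parity b) ⁻¹) (sym (≢⇒⁻¹≡ (≢-sym a≢b))) ⟩
  (parity b ⁻¹ +ℙ parity b) ⁻¹   ≡⟨ cong _⁻¹ (ℙ.p⁻¹+p≡1ℙ (parity b)) ⟩
  0ℙ                             ∎)
  where open ≡-Reasoning

module Excursion (i j : ℕ) (i<j : i < j) (i≢j : parity i ≢ parity j) where

  inside : ℕ → Bool
  inside p = (i <ᵇ p) ∧ (p ≤ᵇ j)

  -- Outside (i, j] the path zigzags between heights 0 and 1; on (i, j] it zigzags one level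
  -- higher, so the up-step at i starts an excursion that the down-step at j ends.
  H : ℕ → ℕ
  H p = if inside p then suc (zigzag i + zigzag (suc (p + i))) else zigzag p

  H-inside : ∀ {p} → i < p → p ≤ j → H p ≡ suc (zigzag i + zigzag (suc (p + i)))
  H-inside {p} i<p p≤j = if-T {b = inside p} (Equivalence.from T-∧ (<⇒<ᵇ i<p , ≤⇒≤ᵇ p≤j))

  H-before : ∀ {p} → p ≤ i → H p ≡ zigzag p
  H-before {p} p≤i = if-¬T {b = inside p} (λ t → ≤⇒≯ p≤i (<ᵇ⇒< i p (proj₁ (Equivalence.to T-∧ t))))

  H-after : ∀ {p} → j < p → H p ≡ zigzag p
  H-after {p} j<p = if-¬T {b = inside p} (λ t → <⇒≱ j<p (≤ᵇ⇒≤ p j (proj₂ (Equivalence.to T-∧ t))))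

  H-adjacent : ∀ t → Adjacent (H t) (H (suc t))
  H-adjacent t with <-cmp t i
  ... | tri< t<i _ _ rewrite H-before (<⇒≤ t<i) | H-before t<i = zigzag-adjacent t
  ... | tri≈ _ refl _ rewrite H-before (≤-refl {t}) | H-inside (n<1+n t) i<j
                            | zigzag-double t | +-identityʳ (zigzag t) = inj₁ refl
  ... | tri> _ _ i<t with <-cmp t j
  ...   | tri< t<j _ _ rewrite H-inside i<t (<⇒≤ t<j) | H-inside (m<n⇒m<1+n i<t) t<j =
    adjacent-+ (suc (zigzag i)) (zigzag-adjacent (suc (t + i)))
  ...   | tri≈ _ refl _ rewrite H-inside i<t (≤-refl {t}) | H-after (n<1+n t) = inj₂ (cong suc (begin
    zigzag i + zigzag (suc (t + i))  ≡⟨ cong (zigzag i +_) (zigzag-closes t i (≢-sym i≢j)) ⟩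
    zigzag i + 0                     ≡⟨ +-identityʳ _ ⟩
    zigzag i                         ≡⟨ cong bit (sym (trans (parity-suc t) (≢⇒⁻¹≡ (≢-sym i≢j)))) ⟩
    zigzag (suc t)                   ∎))
    where open ≡-Reasoning
  ...   | tri> _ _ j<t rewrite H-after j<t | H-after (m<n⇒m<1+n j<t) = zigzag-adjacent t

  above : ∀ t → i < t → t ≤ j → H i < H t
  above t i<t t≤j rewrite H-before (≤-refl {i}) | H-inside i<t t≤j = s≤s (m≤m+n _ _)

  returns : H (suc j) ≡ H i
  returns rewrite H-after (n<1+n j) | H-before (≤-refl {i}) =
    cong bit (trans (parity-suc j) (≢⇒⁻¹≡ (≢-sym i≢j)))

excursion : ∀ {n} (x y : Fin (2 * n)) → toℕ x < toℕ y → parity (toℕ x) ≢ parity (toℕ y) →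
            ∃ λ (D : Dyck n) → tunnel (word D) x ≡ just y × tunnel (word D) y ≡ just x
excursion {n} x y x<y x≢y =
  heightFunction⇒dyck (wordOf H) isHeight end , HeightFunction.tunnel-excursion isHeight x y x<y above returns
  where
  open Excursion (toℕ x) (toℕ y) x<y x≢y
  isHeight : IsHeight (wordOf H) H
  isHeight = wordOf-isHeight (H-before z≤n) H-adjacent
  end : H (2 * n) ≡ 0
  end = trans (H-after (toℕ<n y)) (trans (cong (zigzag ∘ (n +_)) (+-identityʳ n)) (zigzag-double n))

tunnel-pairing-exists : ∀ {n} (x y : Fin (2 * n)) → parity (toℕ x) ≢ parity (toℕ y) →
                  ∃ λ (D : Dyck n) → tunnel (word D) x ≡ just y
tunnel-pairing-exists x y x≢y with <-cmp (toℕ x) (toℕ y)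
... | tri< x<y _ _ = let D , x↦y , _ = excursion x y x<y x≢y in D , x↦y
... | tri≈ _ x≡y _ = contradiction (cong parity x≡y) x≢y
... | tri> _ _ y<x = let D , _ , x↦y = excursion y x y<x (≢-sym x≢y) in D , x↦y

-- σ-paths

valueParity : ∀ {m} → Permutation′ m → Fin m → Parity
valueParity σ l = parity (toℕ (σ ⟨$⟩ʳ l))

parityAt-found : ∀ {m} (σ : Permutation′ m) p l →
                 findᵇ (λ i → toℕ i ≡ᵇ p) (allFin m) ≡ just l → parityAt σ p ≡ toℕ (σ ⟨$⟩ʳ l) % 2
parityAt-found {m} σ p l eq with findᵇ (λ i → toℕ i ≡ᵇ p) (allFin m)
parityAt-found σ p l refl | just .l = refl

parityAt≡bit : ∀ {m} (σ : Permutation′ m) l → parityAt σ (toℕ l) ≡ bit (valueParity σ l)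
parityAt≡bit σ l = trans (parityAt-found σ (toℕ l) l (find-first _ id l (≡⇒≡ᵇ (toℕ l) _ refl) earlier))
                         (%2≡bit∘parity (toℕ (σ ⟨$⟩ʳ l)))
  where
  earlier : ∀ i → toℕ i < toℕ l → ¬ T (toℕ i ≡ᵇ toℕ l)
  earlier i i<l t = <⇒≢ i<l (≡ᵇ⇒≡ _ _ t)

valueParity-≡ : ∀ {m} (σ : Permutation′ m) l l′ →
                parityAt σ (toℕ l) ≡ parityAt σ (toℕ l′) → valueParity σ l ≡ valueParity σ l′
valueParity-≡ σ l l′ eq = bit-injective (trans (sym (parityAt≡bit σ l)) (trans eq (parityAt≡bit σ l′)))

valueParity-≢ : ∀ {m} (σ : Permutation′ m) l l′ →
                parityAt σ (toℕ l) ≢ parityAt σ (toℕ l′) → valueParity σ l ≢ valueParity σ l′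
valueParity-≢ σ l l′ ne eq = ne (trans (parityAt≡bit σ l) (trans (cong bit eq) (sym (parityAt≡bit σ l′))))

=MF⇒≡ : ∀ {m} (r : Maybe (Fin m)) y → T (r =MF y) → r ≡ just y
=MF⇒≡ (just x) y t = cong just (toℕ-injective (≡ᵇ⇒≡ _ _ t))

module _ {m} (σ : Permutation′ m) where

  σPath≡d : ∀ w (k l : Fin m) → toℕ l ≤ toℕ k → tunnel w (σ ⟨$⟩ʳ k) ≡ just (σ ⟨$⟩ʳ l) →
            σPath σ w k ≡ d
  σPath≡d w k l l≤k partner =
    if-T (Any.any⁺ _ (Any.tabulate⁺ l (Equivalence.from T-∧ (≤⇒≤ᵇ l≤k , matched))))
    where
    matched : T (tunnel w (σ ⟨$⟩ʳ k) =MF (σ ⟨$⟩ʳ l))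
    matched rewrite partner = ≡⇒≡ᵇ (toℕ (σ ⟨$⟩ʳ l)) _ refl

  σPath≡u : ∀ w (k : Fin m) → (∀ l → toℕ l ≤ toℕ k → tunnel w (σ ⟨$⟩ʳ k) ≢ just (σ ⟨$⟩ʳ l)) →
            σPath σ w k ≡ u
  σPath≡u w k unmatched = if-¬T λ t →
    let l , q = Any.tabulate⁻ (Any.any⁻ _ _ t)
        l≤k , matched = Equivalence.to T-∧ q
    in  unmatched l (≤ᵇ⇒≤ _ _ l≤k) (=MF⇒≡ _ _ matched)

module _ {n} (σ : Permutation′ (2 * n)) where

  σPath≡u-constant-prefix : ∀ k → (∀ l → toℕ l ≤ toℕ k → valueParity σ l ≡ valueParity σ k) →
                            ∀ (D : Dyck n) → σPath σ (word D) k ≡ u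
  σPath≡u-constant-prefix k same D = σPath≡u σ (word D) k λ l l≤k partner →
    HeightFunction.tunnel-flips-parity (dyck-isHeight D) _ _ partner (sym (same l l≤k))

  σPath≡d-constant-suffix : ∀ k → (∀ l → toℕ k ≤ toℕ l → valueParity σ l ≡ valueParity σ k) →
                            ∀ (D : Dyck n) → σPath σ (word D) k ≡ d
  σPath≡d-constant-suffix k same D =
    let y , partner = HeightFunction.tunnel-total (dyck-isHeight D) (dyckHeight-end D) (σ ⟨$⟩ʳ k)
    in  σPath≡d σ (word D) k (σ ⟨$⟩ˡ y) (earlier y partner) (trans partner (cong just (sym (inverseʳ σ))))
    where
    earlier : ∀ y → tunnel (word D) (σ ⟨$⟩ʳ k) ≡ just y → toℕ (σ ⟨$⟩ˡ y) ≤ toℕ k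
    earlier y partner = ≮⇒≥ λ k<l → HeightFunction.tunnel-flips-parity (dyck-isHeight D) _ _ partner
      (trans (sym (same (σ ⟨$⟩ˡ y) (<⇒≤ k<l))) (cong (parity ∘ toℕ) (inverseʳ σ)))

  σPath≡d-for-some-path : ∀ k l → toℕ l ≤ toℕ k → valueParity σ l ≢ valueParity σ k →
                      ∃ λ (D : Dyck n) → σPath σ (word D) k ≡ d
  σPath≡d-for-some-path k l l≤k differ =
    let D , partner = tunnel-pairing-exists (σ ⟨$⟩ʳ k) (σ ⟨$⟩ʳ l) (≢-sym differ)
    in  D , σPath≡d σ (word D) k l l≤k partner

  σPath≡u-for-some-path : ∀ k k′ → toℕ k′ ≡ suc (toℕ k) → valueParity σ k ≢ valueParity σ k′ →
                      ∃ λ (D : Dyck n) → σPath σ (word D) k ≡ u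
  σPath≡u-for-some-path k k′ next differ =
    let D , partner = tunnel-pairing-exists (σ ⟨$⟩ʳ k) (σ ⟨$⟩ʳ k′) differ
    in  D , σPath≡u σ (word D) k λ l l≤k partner′ →
          n≮n (toℕ k) (subst (_≤ toℕ k) (trans (cong toℕ (l≡k′ (trans (sym partner′) partner))) next) l≤k)
    where
    l≡k′ : ∀ {l} → just (σ ⟨$⟩ʳ l) ≡ just (σ ⟨$⟩ʳ k′) → l ≡ k′
    l≡k′ eq = trans (sym (inverseˡ σ)) (trans (cong (σ ⟨$⟩ˡ_) (just-injective eq)) (inverseˡ σ))

-- Runs of equal parity

-- The predicates searched by par, which unfolds to
-- (firstFrom (endsInitialRun σ) m 1 , firstFrom (startsFinalRun σ) m 1).
endsInitialRun : ∀ {m} → Permutation′ m → ℕ → Bool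
endsInitialRun σ a = not (parityAt σ (a ∸ 1) ≡ᵇ parityAt σ a)

startsFinalRun : ∀ {m} → Permutation′ m → ℕ → Bool
startsFinalRun {m} σ b = not (parityAt σ (m ∸ b) ≡ᵇ parityAt σ (m ∸ b ∸ 1))

not-≡ᵇ-reflects-≢ : ∀ x y → Reflects (x ≢ y) (not (x ≡ᵇ y))
not-≡ᵇ-reflects-≢ x y = ¬-reflects (proof (x ≟ y))

not-≡ᵇ-false⇒≡ : ∀ {x y} → not (x ≡ᵇ y) ≡ false → x ≡ y
not-≡ᵇ-false⇒≡ {x} {y} e = ≡ᵇ⇒≡ x y (Equivalence.from T-≡ (not-injective e))

reflects-equivalent : ∀ {A B : Set} {a b} → Reflects A a → Reflects B b → A ⇔ B → a ≡ b
reflects-equivalent (ofʸ _)  (ofʸ _)  _   = refl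
reflects-equivalent (ofʸ a)  (ofⁿ ¬b) A⇔B = contradiction (Equivalence.to A⇔B a) ¬b
reflects-equivalent (ofⁿ ¬a) (ofʸ b)  A⇔B = contradiction (Equivalence.from A⇔B b) ¬a
reflects-equivalent (ofⁿ _)  (ofⁿ _)  _   = refl

FalseBetween : (ℕ → Bool) → ℕ → ℕ → Set
FalseBetween p s a = ∀ j → s ≤ j → j < a → p j ≡ false

FalseBetween-empty : ∀ p s → FalseBetween p s s
FalseBetween-empty p s j s≤j j<s = contradiction s≤j (<⇒≱ j<s)

FalseBetween-cons : ∀ {p s a} → p s ≡ false → FalseBetween p (suc s) a → FalseBetween p s a
FalseBetween-cons ps none j s≤j j<a with m≤n⇒m<n∨m≡n s≤j
... | inj₁ s<j  = none j s<j j<a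
... | inj₂ refl = ps

firstFrom-cong : ∀ (p q : ℕ → Bool) f s →
                 (∀ a → s ≤ a → a < s + f → FalseBetween p s a → FalseBetween q s a → p a ≡ q a) →
                 firstFrom p f s ≡ firstFrom q f s
firstFrom-cong p q zero    s agree = refl
firstFrom-cong p q (suc f) s agree
  with p s in ps | q s in qs | agree s ≤-refl (m<m+n s z<s) (FalseBetween-empty p s) (FalseBetween-empty q s)
... | true  | true  | _ = refl
... | false | false | _ = firstFrom-cong p q f (suc s) λ a s<a a<1+s+f noneP noneQ →
  agree a (<⇒≤ s<a) (subst (a <_) (sym (+-suc s f)) a<1+s+f) (FalseBetween-cons ps noneP) (FalseBetween-cons qs noneQ)

[m∸n]∸1≡m∸[1+n] : ∀ x j → x ∸ j ∸ 1 ≡ x ∸ suc j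
[m∸n]∸1≡m∸[1+n] x j = trans (∸-+-assoc x j 1) (cong (x ∸_) (+-comm j 1))

module _ {m} (σ : Permutation′ m) where

  InitialRun : ℕ → Set
  InitialRun a = ∀ p → p < a → parityAt σ p ≡ parityAt σ 0

  initialRun : ∀ a → FalseBetween (endsInitialRun σ) 1 a → InitialRun a
  initialRun a none zero    _     = refl
  initialRun a none (suc p) 1+p<a =
    trans (sym (not-≡ᵇ-false⇒≡ (none (suc p) (s≤s z≤n) 1+p<a))) (initialRun a none p (<-trans (n<1+n p) 1+p<a))

  ¬InitialRun-whole : 2 ≤ m → ¬ InitialRun m
  ¬InitialRun-whole 2≤m run = contradiction (trans (value (≤-trans (s≤s z≤n) 2≤m)) (sym (value 2≤m))) λ ()
    where
    value : ∀ {v} → v < m → bit (parity v) ≡ parityAt σ 0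
    value {v} v<m = begin
      bit (parity v)                                ≡⟨ cong (bit ∘ parity) (sym (toℕ-fromℕ< v<m)) ⟩
      bit (parity (toℕ (fromℕ< v<m)))               ≡⟨ cong (bit ∘ parity ∘ toℕ) (sym (inverseʳ σ)) ⟩
      bit (valueParity σ (σ ⟨$⟩ˡ fromℕ< v<m))       ≡⟨ sym (parityAt≡bit σ _) ⟩
      parityAt σ (toℕ (σ ⟨$⟩ˡ fromℕ< v<m))          ≡⟨ run _ (toℕ<n (σ ⟨$⟩ˡ fromℕ< v<m)) ⟩
      parityAt σ 0                                  ∎
      where open ≡-Reasoning

  FinalRun : ℕ → Set
  FinalRun b = ∀ j → 1 ≤ j → j ≤ b → parityAt σ (m ∸ j) ≡ parityAt σ (m ∸ 1)

  finalRun : ∀ b → FalseBetween (startsFinalRun σ) 1 b → FinalRun b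
  finalRun b none (suc zero)    _ _     = refl
  finalRun b none (suc (suc j)) _ 2+j≤b =
    trans (cong (parityAt σ) (sym ([m∸n]∸1≡m∸[1+n] m (suc j))))
          (trans (sym (not-≡ᵇ-false⇒≡ (none (suc j) (s≤s z≤n) 2+j≤b)))
                 (finalRun b none (suc j) (s≤s z≤n) (<⇒≤ 2+j≤b)))

  finalRun-suc : ∀ b → 1 ≤ b → FinalRun b → parityAt σ (m ∸ b) ≡ parityAt σ (m ∸ b ∸ 1) →
                 FinalRun (suc b)
  finalRun-suc b 1≤b run eq j 1≤j j≤1+b with m≤n⇒m<n∨m≡n j≤1+b
  ... | inj₁ j<1+b = run j 1≤j (s≤s⁻¹ j<1+b)
  ... | inj₂ refl  =
    trans (cong (parityAt σ) (sym ([m∸n]∸1≡m∸[1+n] m b))) (trans (sym eq) (run b 1≤b ≤-refl))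

  finalRun-positions : ∀ c → c ≤ m → FinalRun c →
                       ∀ p → m ∸ c ≤ p → p < m → parityAt σ p ≡ parityAt σ (m ∸ 1)
  finalRun-positions c c≤m run p m∸c≤p p<m =
    subst (λ q → parityAt σ q ≡ parityAt σ (m ∸ 1)) (m∸[m∸n]≡n (<⇒≤ p<m))
          (run (m ∸ p) (m<n⇒0<n∸m p<m) (subst (m ∸ p ≤_) (m∸[m∸n]≡n c≤m) (∸-monoʳ-≤ m m∸c≤p)))

  startsFinalRun-whole : startsFinalRun σ m ≡ false
  startsFinalRun-whole rewrite n∸n≡0 m = cong not (Equivalence.to T-≡ (≡⇒≡ᵇ (parityAt σ 0) _ refl))

positionBefore : ∀ {m b} → b < m → Fin m
positionBefore b<m = fromℕ< (∸-monoʳ-< z<s b<m)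

module _ {n} (σ : Permutation′ (2 * n)) where

  initialBreak⇔ : ∀ a → 1 ≤ a → (a<m : a < 2 * n) → InitialRun σ a →
                  parityAt σ (a ∸ 1) ≢ parityAt σ a ⇔
                  ∃ λ (D : Dyck n) → σPath σ (word D) (fromℕ< a<m) ≡ d
  initialBreak⇔ a 1≤a a<m run = mk⇔ break⇒d d⇒break
    where
    a∸1<a : a ∸ 1 < a
    a∸1<a = ∸-monoʳ-< z<s 1≤a
    k = fromℕ< a<m
    prev = fromℕ< (<-trans a∸1<a a<m)
    k≡a : toℕ k ≡ a
    k≡a = toℕ-fromℕ< a<m
    prev≡a∸1 : toℕ prev ≡ a ∸ 1
    prev≡a∸1 = toℕ-fromℕ< (<-trans a∸1<a a<m)
    break⇒d : parityAt σ (a ∸ 1) ≢ parityAt σ a → ∃ λ (D : Dyck n) → σPath σ (word D) k ≡ d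
    break⇒d ne = σPath≡d-for-some-path σ k prev (subst₂ _≤_ (sym prev≡a∸1) (sym k≡a) (<⇒≤ a∸1<a))
      (valueParity-≢ σ prev k (ne ∘ subst₂ (λ x y → parityAt σ x ≡ parityAt σ y) prev≡a∸1 k≡a))
    d⇒break : (∃ λ (D : Dyck n) → σPath σ (word D) k ≡ d) → ¬ parityAt σ (a ∸ 1) ≡ parityAt σ a
    d⇒break (D , path≡d) eq = contradiction (trans (sym path≡d) (σPath≡u-constant-prefix σ k same D)) λ ()
      where
      upTo : ∀ p → p ≤ a → parityAt σ p ≡ parityAt σ 0
      upTo p p≤a with m≤n⇒m<n∨m≡n p≤a
      ... | inj₁ p<a  = run p p<a
      ... | inj₂ refl = trans (sym eq) (run (p ∸ 1) a∸1<a)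
      same : ∀ l → toℕ l ≤ toℕ k → valueParity σ l ≡ valueParity σ k
      same l l≤k = valueParity-≡ σ l k (trans (upTo (toℕ l) (subst (toℕ l ≤_) k≡a l≤k))
                                           (sym (upTo (toℕ k) (≤-reflexive k≡a))))

  finalBreak⇔ : ∀ b → 1 ≤ b → (b<m : b < 2 * n) → FinalRun σ b →
                parityAt σ (2 * n ∸ b) ≢ parityAt σ (2 * n ∸ b ∸ 1) ⇔
                ∃ λ (D : Dyck n) → σPath σ (word D) (positionBefore b<m) ≡ u
  finalBreak⇔ b 1≤b b<m run = mk⇔ break⇒u u⇒break
    where
    k = positionBefore b<m
    next = fromℕ< (∸-monoʳ-< 1≤b (<⇒≤ b<m))
    k≡ : toℕ k ≡ 2 * n ∸ b ∸ 1
    k≡ = trans (toℕ-fromℕ< (∸-monoʳ-< z<s b<m)) (sym ([m∸n]∸1≡m∸[1+n] (2 * n) b))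
    next≡ : toℕ next ≡ 2 * n ∸ b
    next≡ = toℕ-fromℕ< (∸-monoʳ-< 1≤b (<⇒≤ b<m))
    next-follows : toℕ next ≡ suc (toℕ k)
    next-follows =
      trans next≡ (trans (+-∸-assoc 1 b<m) (cong suc (trans (sym ([m∸n]∸1≡m∸[1+n] (2 * n) b)) (sym k≡))))
    break⇒u : parityAt σ (2 * n ∸ b) ≢ parityAt σ (2 * n ∸ b ∸ 1) →
              ∃ λ (D : Dyck n) → σPath σ (word D) k ≡ u
    break⇒u ne = σPath≡u-for-some-path σ k next next-follows
      (valueParity-≢ σ k next (ne ∘ sym ∘ subst₂ (λ x y → parityAt σ x ≡ parityAt σ y) k≡ next≡))
    u⇒break : (∃ λ (D : Dyck n) → σPath σ (word D) k ≡ u) →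
              ¬ parityAt σ (2 * n ∸ b) ≡ parityAt σ (2 * n ∸ b ∸ 1)
    u⇒break (D , path≡u) eq = contradiction (trans (sym path≡u) (σPath≡d-constant-suffix σ k same D)) λ ()
      where
      toEnd : ∀ p → toℕ k ≤ p → p < 2 * n → parityAt σ p ≡ parityAt σ (2 * n ∸ 1)
      toEnd p k≤p = finalRun-positions σ (suc b) b<m (finalRun-suc σ b 1≤b run eq) p
                      (subst (_≤ p) (trans k≡ ([m∸n]∸1≡m∸[1+n] (2 * n) b)) k≤p)
      same : ∀ l → toℕ k ≤ toℕ l → valueParity σ l ≡ valueParity σ k
      same l k≤l =
        valueParity-≡ σ l k (trans (toEnd (toℕ l) k≤l (toℕ<n l)) (sym (toEnd (toℕ k) ≤-refl (toℕ<n k))))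

module _ {n} {λ' μ : Permutation′ (2 * n)} (λ∼μ : _∼_ {n} λ' μ) where

  sameClass : ∀ k s → (∃ λ (D : Dyck n) → σPath λ' (word D) k ≡ s) ⇔
                      (∃ λ (D : Dyck n) → σPath μ (word D) k ≡ s)
  sameClass k s = mk⇔ (λ (D , e) → D , trans (sym (λ∼μ D k)) e) (λ (D , e) → D , trans (λ∼μ D k) e)

  endsInitialRun-invariant : ∀ a → 1 ≤ a → a < 2 * n →
    FalseBetween (endsInitialRun λ') 1 a → FalseBetween (endsInitialRun μ) 1 a →
    endsInitialRun λ' a ≡ endsInitialRun μ a
  endsInitialRun-invariant a 1≤a a<m noneλ noneμ =
    reflects-equivalent (not-≡ᵇ-reflects-≢ _ _) (not-≡ᵇ-reflects-≢ _ _) (⇔.trans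
      (initialBreak⇔ λ' a 1≤a a<m (initialRun λ' a noneλ))
      (⇔.trans (sameClass _ d) (⇔.sym (initialBreak⇔ μ a 1≤a a<m (initialRun μ a noneμ)))))

  startsFinalRun-invariant : ∀ b → 1 ≤ b → b < 2 * n →
    FalseBetween (startsFinalRun λ') 1 b → FalseBetween (startsFinalRun μ) 1 b →
    startsFinalRun λ' b ≡ startsFinalRun μ b
  startsFinalRun-invariant b 1≤b b<m noneλ noneμ =
    reflects-equivalent (not-≡ᵇ-reflects-≢ _ _) (not-≡ᵇ-reflects-≢ _ _) (⇔.trans
      (finalBreak⇔ λ' b 1≤b b<m (finalRun λ' b noneλ))
      (⇔.trans (sameClass _ u) (⇔.sym (finalBreak⇔ μ b 1≤b b<m (finalRun μ b noneμ)))))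

proposition3 : (n : ℕ) → 3 ≤ n → (λ' μ : Permutation′ (2 * n)) → _∼_ {n} λ' μ → par λ' ≡ par μ
proposition3 n 3≤n λ' μ λ∼μ = cong₂ _,_
  (firstFrom-cong (endsInitialRun λ') (endsInitialRun μ) (2 * n) 1 initialAgree)
  (firstFrom-cong (startsFinalRun λ') (startsFinalRun μ) (2 * n) 1 finalAgree)
  where
  2≤2n : 2 ≤ 2 * n
  2≤2n = ≤-trans (≤-trans (n≤1+n 2) 3≤n) (m≤m+n n (n + 0))
  initialAgree : ∀ a → 1 ≤ a → a < 1 + 2 * n → FalseBetween (endsInitialRun λ') 1 a →
                 FalseBetween (endsInitialRun μ) 1 a → endsInitialRun λ' a ≡ endsInitialRun μ a
  initialAgree a 1≤a a≤2n noneλ noneμ with m≤n⇒m<n∨m≡n (s≤s⁻¹ a≤2n)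
  ... | inj₁ a<2n = endsInitialRun-invariant λ∼μ a 1≤a a<2n noneλ noneμ
  ... | inj₂ refl = contradiction (initialRun λ' a noneλ) (¬InitialRun-whole λ' 2≤2n)
  finalAgree : ∀ b → 1 ≤ b → b < 1 + 2 * n → FalseBetween (startsFinalRun λ') 1 b →
               FalseBetween (startsFinalRun μ) 1 b → startsFinalRun λ' b ≡ startsFinalRun μ b
  finalAgree b 1≤b b≤2n noneλ noneμ with m≤n⇒m<n∨m≡n (s≤s⁻¹ b≤2n)
  ... | inj₁ b<2n = startsFinalRun-invariant λ∼μ b 1≤b b<2n noneλ noneμ
  ... | inj₂ refl = trans (startsFinalRun-whole λ') (sym (startsFinalRun-whole μ))
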